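{- Let $G$ be a bridgeless graph, let $C$ be a $6$-circuit of $G$ all of whose vertices have degree three in $G$, and let $\phi$ be a $C$-extensible chain on $G$ such that $C$ has a nowhere-zero boundary in $\phi$. Let $o$ be a natural $C$-boundary-ordering. Then there exists a $C$-extensible chain $\phi'$ on $G$ that is a $C$-modification of $\phi$ such that $\phi'(C,o)=a_0a_1a_2a_3a_4a_5$ satisfies at least one of the following conditions: (1) $a_0=a_1$, $a_2=a_3$, $a_4=a_5$; (2) $a_0=a_5$, $a_1=a_2$, $a_3=a_4$; (3) $a_0=a_3$, $a_1=a_2$, $a_4=a_5$; (4) $a_0=a_5$, $a_1=a_4$, $a_2=a_3$; (5) $a_0=a_1$, $a_2=a_5$, $a_3=a_4$; (6) $a_0=a_3$, $a_1=a_4$, $a_2=a_5$.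
   Context: Graphs are finite and may have parallel edges. A circuit is a connected $2$-regular subgraph; a $6$-circuit has $6$ edges. Let $\mathbb{Z}_2\times\mathbb{Z}_2$ have identity $0$. For a vertex $v$, $\partial_G(v)$ is the set of edges with exactly one end at $v$; for a subgraph $H$, $\partial_G(H)$ is the multiset of edges of $E(G)\setminus E(H)$ in which each edge appears as many times as the number of its endvertices in $V(H)$. A chain is a function $\phi:E(G)\to\mathbb{Z}_2\times\mathbb{Z}_2$, $Z(\phi)=\{e:\phi(e)=0\}$; $v$ is zero-sum if $\sum_{e\in\partial_G(v)}\phi(e)=0$. For a connected subgraph $H$: $\phi$ is $H$-extensible if all vertices outside $V(H)$ are zero-sum in $\phi$; $H$ has a nowhere-zero boundary in $\phi$ if $\partial_G(H)\cap Z(\phi)=\emptyset$; an $H$-extensible chain $\phi'$ is an $H$-modification of $\phi$ if $Z(\phi)\setminus E(H)=Z(\phi')\setminus E(H)$. If $v_0,\dots,v_5$ are the vertices of $C$ in consecutive order along $C$, the natural $C$-boundary-ordering is $o=e_0,\dots,e_5$ with $e_i$ the unique edge not in $E(C)$ incident with $v_i$, and $\phi'(C,o)$ is the string $\phi'(e_0)\cdots\phi'(e_5)$. -}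

module Defs where

open import Data.Nat using (ℕ; zero; suc; _+_)
open import Data.Bool using (Bool; true; false; _xor_; if_then_else_)
open import Data.Bool.Base using (T)
open import Data.Fin using (Fin; zero; suc; _≟_)
open import Data.List using (List; foldr; map)
open import Data.List.Base using (allFin)
open import Data.Product using (_×_; _,_; proj₁; proj₂; Σ; ∃)
open import Data.Sum using (_⊎_)
open import Relation.Nullary using (¬_)
open import Relation.Nullary.Decidable using (⌊_⌋)
open import Relation.Binary.PropositionalEquality using (_≡_; _≢_)

-- Finite graphs, possibly with parallel edges and loops.
-- Vertices are Fin n, edges are Fin m, each edge has an (unordered)
-- pair of endvertices, recorded as an ordered pair.

record Graph : Set where
  field
    n    : ℕ
    m    : ℕ
    ends : Fin m → Fin n × Fin n

open Graph public

Vertex : Graph → Set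
Vertex G = Fin (n G)

Edge : Graph → Set
Edge G = Fin (m G)

Joins : (G : Graph) → Edge G → Vertex G → Vertex G → Set
Joins G e x y = (ends G e ≡ (x , y)) ⊎ (ends G e ≡ (y , x))

Incident : (G : Graph) → Edge G → Vertex G → Set
Incident G e v = (proj₁ (ends G e) ≡ v) ⊎ (proj₂ (ends G e) ≡ v)

-- degree: number of edge-ends at v (a loop counts twice)
toℕ𝔹 : Bool → ℕ
toℕ𝔹 true  = 1
toℕ𝔹 false = 0

endsAt : (G : Graph) → Edge G → Vertex G → ℕ
endsAt G e v = toℕ𝔹 ⌊ proj₁ (ends G e) ≟ v ⌋ + toℕ𝔹 ⌊ proj₂ (ends G e) ≟ v ⌋

degree : (G : Graph) → Vertex G → ℕ
degree G v = foldr _+_ 0 (map (λ e → endsAt G e v) (allFin (m G)))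

data ConnectedAvoiding (G : Graph) (d : Edge G) : Vertex G → Vertex G → Set where
  here : ∀ {x} → ConnectedAvoiding G d x x
  step : ∀ {x y z} (e : Edge G) → e ≢ d → Joins G e x y →
         ConnectedAvoiding G d y z → ConnectedAvoiding G d x z

-- d is a bridge iff deleting it increases the number of components,
-- i.e. its endvertices are not connected in G - d.
IsBridge : (G : Graph) → Edge G → Set
IsBridge G d = ¬ ConnectedAvoiding G d (proj₁ (ends G d)) (proj₂ (ends G d))

Bridgeless : Graph → Set
Bridgeless G = ∀ d → ¬ IsBridge G d

Z2² : Set
Z2² = Bool × Bool

0ᶻ : Z2²
0ᶻ = false , false

_⊕_ : Z2² → Z2² → Z2²
(a , b) ⊕ (c , d) = (a xor c) , (b xor d)

Chain : Graph → Set
Chain G = Edge G → Z2²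

-- e ∈ ∂_G(v): exactly one end of e is v
inBoundary : (G : Graph) → Edge G → Vertex G → Bool
inBoundary G e v = ⌊ proj₁ (ends G e) ≟ v ⌋ xor ⌊ proj₂ (ends G e) ≟ v ⌋

boundarySum : (G : Graph) → Chain G → Vertex G → Z2²
boundarySum G φ v =
  foldr _⊕_ 0ᶻ (map (λ e → if inBoundary G e v then φ e else 0ᶻ) (allFin (m G)))

ZeroSum : (G : Graph) → Chain G → Vertex G → Set
ZeroSum G φ v = boundarySum G φ v ≡ 0ᶻ

next6 : Fin 6 → Fin 6
next6 zero = suc zero
next6 (suc zero) = suc (suc zero)
next6 (suc (suc zero)) = suc (suc (suc zero))
next6 (suc (suc (suc zero))) = suc (suc (suc (suc zero)))
next6 (suc (suc (suc (suc zero)))) = suc (suc (suc (suc (suc zero))))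
next6 (suc (suc (suc (suc (suc zero))))) = zero

Injective6 : {A : Set} → (Fin 6 → A) → Set
Injective6 f = ∀ i j → f i ≡ f j → i ≡ j

record SixCircuit (G : Graph) : Set where
  field
    vtx      : Fin 6 → Vertex G
    edg      : Fin 6 → Edge G
    vtx-inj  : Injective6 vtx
    edg-inj  : Injective6 edg
    edg-join : ∀ i → Joins G (edg i) (vtx i) (vtx (next6 i))

open SixCircuit public

InV : {G : Graph} → SixCircuit G → Vertex G → Set
InV C u = ∃ λ i → vtx C i ≡ u

InE : {G : Graph} → SixCircuit G → Edge G → Set
InE C d = ∃ λ i → edg C i ≡ d

Extensible : (G : Graph) → SixCircuit G → Chain G → Set
Extensible G C φ = ∀ u → ¬ InV C u → ZeroSum G φ u

-- natural C-boundary-ordering: eᵢ is the (unique, by degree 3) edge not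
-- in E(C) incident with vᵢ
NaturalOrdering : (G : Graph) → SixCircuit G → (Fin 6 → Edge G) → Set
NaturalOrdering G C o = ∀ i → (¬ InE C (o i)) × Incident G (o i) (vtx C i)

NowhereZeroBoundary : (G : Graph) → SixCircuit G → Chain G → Set
NowhereZeroBoundary G C φ =
  ∀ d → ¬ InE C d → ∀ u → InV C u → Incident G d u → ¬ (φ d ≡ 0ᶻ)

SameZerosOutside : (G : Graph) → SixCircuit G → Chain G → Chain G → Set
SameZerosOutside G C φ φ' =
  ∀ d → ¬ InE C d → ((φ d ≡ 0ᶻ → φ' d ≡ 0ᶻ) × (φ' d ≡ 0ᶻ → φ d ≡ 0ᶻ))

Modification : (G : Graph) → SixCircuit G → Chain G → Chain G → Set
Modification G C φ φ' = Extensible G C φ' × SameZerosOutside G C φ φ'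

f0 f1 f2 f3 f4 f5 : Fin 6
f0 = zero
f1 = suc zero
f2 = suc (suc zero)
f3 = suc (suc (suc zero))
f4 = suc (suc (suc (suc zero)))
f5 = suc (suc (suc (suc (suc zero))))

GoodString : (Fin 6 → Z2²) → Set
GoodString a =
     (a f0 ≡ a f1 × a f2 ≡ a f3 × a f4 ≡ a f5)
  ⊎ ((a f0 ≡ a f5 × a f1 ≡ a f2 × a f3 ≡ a f4)
  ⊎ ((a f0 ≡ a f3 × a f1 ≡ a f2 × a f4 ≡ a f5)
  ⊎ ((a f0 ≡ a f5 × a f1 ≡ a f4 × a f2 ≡ a f3)
  ⊎ ((a f0 ≡ a f1 × a f2 ≡ a f5 × a f3 ≡ a f4)
  ⊎  (a f0 ≡ a f3 × a f1 ≡ a f4 × a f2 ≡ a f5)))))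

-- Identify each nonzero boundary value with a colour.  For a colour z the
-- edges outside C whose value is one of the two colours other than z form
-- the Kempe subgraph H_z; outside C its vertices are even because φ is
-- zero-sum there, and at vᵢ it has the single edge eᵢ exactly when aᵢ ≠ z.
-- By the handshake lemma the boundary string is therefore balanced.  Walking
-- from vᵢ along unused edges of H_z must end at another odd vertex of H_z,
-- which is some vₖ; adding z along that walk is a C-modification changing
-- exactly aᵢ and aₖ (a Kempe switch).  Since k is not ours to choose, the
-- theorem reduces to a finite game, and an exhaustive computation shows
-- that from every balanced string two switches force one of the six
-- patterns.
module Submission where

open import Algebra.Bundles using (CommutativeRing; CommutativeMonoid)
open import Data.Bool using (Bool; true; false; not; _∧_; _xor_; if_then_else_)
open import Data.Bool.Properties
  using ( xor-∧-commutativeRing; ∧-zeroʳ; ∧-identityʳ; ∧-assoc; ∧-comm; ∧-distribˡ-xor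
        ; xor-identityʳ; xor-same; xor-assoc; xor-comm; not-¬ )
  renaming (_≟_ to _≟ᵇ_)
open import Data.Empty using (⊥-elim)
open import Data.Fin using (Fin; zero; suc; _≟_)
open import Data.Fin.Properties using (any?; all?)
open import Data.List using ([]; _∷_; tabulate)
import Data.List as List
open import Data.List.Relation.Unary.All using (All; []; _∷_)
open import Data.List.Relation.Unary.Unique.Propositional using (Unique; []; _∷_)
open import Data.Nat using (ℕ; zero; suc; _+_; _≤_; z≤n; s≤s)
open import Data.Nat.ListAction using (sum)
open import Data.Nat.Properties
  using ( +-0-commutativeMonoid; +-commutativeSemigroup; +-comm; +-identityʳ; +-monoˡ-≤; +-monoʳ-≤
        ; ≤-trans; ≤-reflexive; ≤-pred; suc-injective )
open import Data.Product using (_×_; _,_; proj₁; proj₂; Σ; ∃)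
open import Data.Product.Properties using (≡-dec)
open import Data.Sum using (_⊎_; inj₁; inj₂)
import Data.Sum as Sum
open import Data.Vec using (Vec; []; _∷_; lookup)
import Data.Vec as Vec
open import Data.Vec.Properties using (lookup∘tabulate)
import Data.Vec.Functional as Vector
open import Function using (_∘_)
open import Relation.Binary.Definitions using (DecidableEquality)
open import Relation.Binary.PropositionalEquality
open import Relation.Nullary using (Dec; yes; no; ¬_; ¬?)
open import Relation.Nullary.Decidable using (⌊_⌋; map′; _⊎-dec_; _×-dec_; _→-dec_; toWitness; ⌊⌋-map′)

import Algebra.Properties.CommutativeMonoid.Sum as MonoidSum
import Algebra.Properties.CommutativeSemigroup as SemigroupProperties

open import Defs

open ≡-Reasoning

-- Colours

data Colour : Set where
  red green blue : Colour

col : Colour → Z2²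
col red   = true , false
col green = false , true
col blue  = true , true

colour : Z2² → Colour
colour (true  , false) = red
colour (false , true)  = green
colour _               = blue

col-colour : ∀ x → x ≢ 0ᶻ → col (colour x) ≡ x
col-colour (true  , true)  _   = refl
col-colour (true  , false) _   = refl
col-colour (false , true)  _   = refl
col-colour (false , false) x≢0 = ⊥-elim (x≢0 refl)

_≟ᶜ_ : DecidableEquality Colour
red   ≟ᶜ red   = yes refl
red   ≟ᶜ green = no λ ()
red   ≟ᶜ blue  = no λ ()
green ≟ᶜ red   = no λ ()
green ≟ᶜ green = yes refl
green ≟ᶜ blue  = no λ ()
blue  ≟ᶜ red   = no λ ()
blue  ≟ᶜ green = no λ ()
blue  ≟ᶜ blue  = yes refl

-- junk value c when c ≡ z
third : Colour → Colour → Colour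
third red   green = blue
third red   blue  = green
third green red   = blue
third green blue  = red
third blue  red   = green
third blue  green = red
third _     c     = c

col-third : ∀ z c → c ≢ z → col (third z c) ≡ col c ⊕ col z
col-third red   red   c≢z = ⊥-elim (c≢z refl)
col-third red   green _   = refl
col-third red   blue  _   = refl
col-third green red   _   = refl
col-third green green c≢z = ⊥-elim (c≢z refl)
col-third green blue  _   = refl
col-third blue  red   _   = refl
col-third blue  green _   = refl
col-third blue  blue  c≢z = ⊥-elim (c≢z refl)

-- π z is the character of Z2² with kernel {0, col z}; the edges e with
-- π z (φ e) ≡ true carry the two colours other than z.
π : Colour → Z2² → Bool
π red   (a , b) = b
π green (a , b) = a
π blue  (a , b) = a xor b

xor-commutativeMonoid : CommutativeMonoid _ _
xor-commutativeMonoid = CommutativeRing.+-commutativeMonoid xor-∧-commutativeRing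

open SemigroupProperties (CommutativeMonoid.commutativeSemigroup xor-commutativeMonoid)
  using () renaming (interchange to xor-interchange)
open SemigroupProperties +-commutativeSemigroup using () renaming (x∙yz≈y∙xz to +-left-comm)

π-⊕ : ∀ z x y → π z (x ⊕ y) ≡ π z x xor π z y
π-⊕ red   _       _       = refl
π-⊕ green _       _       = refl
π-⊕ blue  (a , b) (c , d) = xor-interchange a c b d

π-0 : ∀ z → π z 0ᶻ ≡ false
π-0 red   = refl
π-0 green = refl
π-0 blue  = refl

π-col-self : ∀ z → π z (col z) ≡ false
π-col-self red   = refl
π-col-self green = refl
π-col-self blue  = refl

π-col : ∀ z c → c ≢ z → π z (col c) ≡ true
π-col red   red   c≢z = ⊥-elim (c≢z refl)
π-col red   green _   = refl
π-col red   blue  _   = refl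
π-col green red   _   = refl
π-col green green c≢z = ⊥-elim (c≢z refl)
π-col green blue  _   = refl
π-col blue  red   _   = refl
π-col blue  green _   = refl
π-col blue  blue  c≢z = ⊥-elim (c≢z refl)

π-col⇒≢ : ∀ z c → π z (col c) ≡ true → c ≢ z
π-col⇒≢ z c π≡true refl with () ← trans (sym (π-col-self z)) π≡true

π-true⇒≢0 : ∀ z x → π z x ≡ true → x ≢ 0ᶻ
π-true⇒≢0 z x π≡true refl with () ← trans (sym (π-0 z)) π≡true

≡0-by-π : ∀ x → π red x ≡ false → π green x ≡ false → x ≡ 0ᶻ
≡0-by-π (false , false) _ _ = refl

-- Parities and counts

module Parity = MonoidSum xor-commutativeMonoid
module ℕSum = MonoidSum +-0-commutativeMonoid

parity : ∀ {n} → (Fin n → Bool) → Bool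
parity = Parity.sum

⌊⌋-yes : ∀ {A : Set} (d : Dec A) → A → ⌊ d ⌋ ≡ true
⌊⌋-yes (yes _) _ = refl
⌊⌋-yes (no ¬a) a = ⊥-elim (¬a a)

⌊⌋-no : ∀ {A : Set} (d : Dec A) → ¬ A → ⌊ d ⌋ ≡ false
⌊⌋-no (yes a) ¬a = ⊥-elim (¬a a)
⌊⌋-no (no _)  _  = refl

⌊⌋-sound : ∀ {A : Set} (d : Dec A) → ⌊ d ⌋ ≡ true → A
⌊⌋-sound (yes a) _ = a

⌊≟⌋-sym : ∀ {n} (a b : Fin n) → ⌊ a ≟ b ⌋ ≡ ⌊ b ≟ a ⌋
⌊≟⌋-sym a b with a ≟ b
... | yes refl = sym (⌊⌋-yes (a ≟ a) refl)
... | no a≢b   = sym (⌊⌋-no (b ≟ a) (λ b≡a → a≢b (sym b≡a)))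

⌊≟⌋-injective : ∀ {r n} (g : Fin r → Fin n) → (∀ {i j} → g i ≡ g j → i ≡ j) →
                ∀ i j → ⌊ g i ≟ g j ⌋ ≡ ⌊ i ≟ j ⌋
⌊≟⌋-injective g inj i j with i ≟ j
... | yes refl = ⌊⌋-yes (g i ≟ g i) refl
... | no i≢j   = ⌊⌋-no (g i ≟ g j) (λ e → i≢j (inj e))

parity-cong : ∀ {n} {f g : Fin n → Bool} → (∀ i → f i ≡ g i) → parity f ≡ parity g
parity-cong = Parity.sum-cong-≗

parity-false : ∀ n → parity {n} (λ _ → false) ≡ false
parity-false = Parity.sum-replicate-zero

parity-∧ʳ : ∀ {n} (f : Fin n → Bool) b → parity (λ i → f i ∧ b) ≡ parity f ∧ b
parity-∧ʳ f true  = trans (parity-cong (λ i → ∧-identityʳ (f i))) (sym (∧-identityʳ _))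
parity-∧ʳ {n} f false = begin
  parity (λ i → f i ∧ false) ≡⟨ parity-cong (λ i → ∧-zeroʳ (f i)) ⟩
  parity {n} (λ _ → false)   ≡⟨ parity-false n ⟩
  false                      ≡⟨ ∧-zeroʳ (parity f) ⟨
  parity f ∧ false           ∎

parity-select : ∀ {n} (a : Fin n) (g : Fin n → Bool) → parity (λ i → ⌊ a ≟ i ⌋ ∧ g i) ≡ g a
parity-select {suc n} zero    g = trans (cong (g zero xor_) (parity-false n)) (xor-identityʳ (g zero))
parity-select {suc n} (suc a) g = begin
  parity (λ i → ⌊ suc a ≟ suc i ⌋ ∧ g (suc i))
    ≡⟨ parity-cong (λ i → cong (_∧ g (suc i)) (⌊⌋-map′ _ _ (a ≟ i))) ⟩
  parity (λ i → ⌊ a ≟ i ⌋ ∧ g (suc i))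
    ≡⟨ parity-select a (g ∘ suc) ⟩
  g (suc a)
    ∎

parity-single : ∀ {n} (a : Fin n) → parity (λ i → ⌊ a ≟ i ⌋) ≡ true
parity-single a = trans (parity-cong (λ i → sym (∧-identityʳ ⌊ a ≟ i ⌋))) (parity-select a (λ _ → true))

parity-true⇒∃ : ∀ {n} (f : Fin n → Bool) → parity f ≡ true → ∃ λ i → f i ≡ true
parity-true⇒∃ {suc n} f odd with f zero in f₀
... | true  = zero , f₀
... | false with parity-true⇒∃ (f ∘ suc) odd
...   | i , fi = suc i , fi

parity-image : ∀ {r n} (g : Fin r → Fin n) → (∀ {i j} → g i ≡ g j → i ≡ j) →
               (f : Fin n → Bool) → (∀ u → (∀ k → g k ≢ u) → f u ≡ false) →
               parity f ≡ parity (f ∘ g)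
parity-image {r} g inj f off-image = begin
  parity f
    ≡⟨ parity-cong pointwise ⟩
  parity (λ u → parity (λ k → ⌊ g k ≟ u ⌋ ∧ f (g k)))
    ≡⟨ Parity.∑-comm (λ u k → ⌊ g k ≟ u ⌋ ∧ f (g k)) ⟩
  parity (λ k → parity (λ u → ⌊ g k ≟ u ⌋ ∧ f (g k)))
    ≡⟨ parity-cong (λ k → parity-select (g k) (λ _ → f (g k))) ⟩
  parity (f ∘ g)
    ∎
  where
  pointwise : ∀ u → f u ≡ parity (λ k → ⌊ g k ≟ u ⌋ ∧ f (g k))
  pointwise u with any? (λ k → g k ≟ u)
  ... | yes (i , refl) = sym (begin
    parity (λ k → ⌊ g k ≟ g i ⌋ ∧ f (g k))
      ≡⟨ parity-cong (λ k → cong (_∧ f (g k)) (trans (⌊≟⌋-injective g inj k i) (⌊≟⌋-sym k i))) ⟩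
    parity (λ k → ⌊ i ≟ k ⌋ ∧ f (g k))
      ≡⟨ parity-select i (f ∘ g) ⟩
    f (g i)
      ∎)
  ... | no ∉image = begin
    f u
      ≡⟨ off-image u (λ k gk≡u → ∉image (k , gk≡u)) ⟩
    false
      ≡⟨ parity-false r ⟨
    parity {r} (λ _ → false)
      ≡⟨ parity-cong (λ k → cong (_∧ f (g k)) (⌊⌋-no (g k ≟ u) (λ gk≡u → ∉image (k , gk≡u)))) ⟨
    parity (λ k → ⌊ g k ≟ u ⌋ ∧ f (g k))
      ∎

zeroAt : ∀ {n} → Fin n → (Fin n → ℕ) → Fin n → ℕ
zeroAt a g i = if ⌊ a ≟ i ⌋ then 0 else g i

sum-zeroAt : ∀ {n} (a : Fin n) (g : Fin n → ℕ) → ℕSum.sum g ≡ g a + ℕSum.sum (zeroAt a g)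
sum-zeroAt {suc n} zero    g = refl
sum-zeroAt {suc n} (suc a) g = begin
  g zero + ℕSum.sum (g ∘ suc)                           ≡⟨ cong (g zero +_) (sum-zeroAt a (g ∘ suc)) ⟩
  g zero + (g (suc a) + ℕSum.sum (zeroAt a (g ∘ suc)))  ≡⟨ +-left-comm (g zero) (g (suc a)) _ ⟩
  g (suc a) + (g zero + ℕSum.sum (zeroAt a (g ∘ suc)))  ≡⟨ cong (λ s → g (suc a) + (g zero + s)) (ℕSum.sum-cong-≗ shift) ⟩
  g (suc a) + ℕSum.sum (zeroAt (suc a) g)               ∎
  where
  shift : ∀ i → zeroAt a (g ∘ suc) i ≡ zeroAt (suc a) g (suc i)
  shift i = cong (if_then 0 else g (suc i)) (sym (⌊⌋-map′ _ _ (a ≟ i)))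

sum-unique-≤ : ∀ {n} (g : Fin n → ℕ) {as} → Unique as → sum (List.map g as) ≤ ℕSum.sum g
sum-unique-≤ g [] = z≤n
sum-unique-≤ g {a ∷ as} (a∉as ∷ unique) =
  ≤-trans (≤-reflexive (cong (g a +_) (unchanged a∉as)))
    (≤-trans (+-monoʳ-≤ (g a) (sum-unique-≤ (zeroAt a g) unique)) (≤-reflexive (sym (sum-zeroAt a g))))
  where
  unchanged : ∀ {bs} → All (a ≢_) bs → sum (List.map g bs) ≡ sum (List.map (zeroAt a g) bs)
  unchanged [] = refl
  unchanged {b ∷ _} (a≢b ∷ rest) =
    cong₂ _+_ (cong (if_then 0 else g b) (sym (⌊⌋-no (a ≟ b) a≢b))) (unchanged rest)

count : ∀ {n} → (Fin n → Bool) → ℕ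
count f = ℕSum.sum (toℕ𝔹 ∘ f)

count-remove : ∀ {n} (f : Fin n → Bool) a → f a ≡ true → count f ≡ suc (count (λ i → f i xor ⌊ a ≟ i ⌋))
count-remove f a fa = begin
  count f                                       ≡⟨ sum-zeroAt a (toℕ𝔹 ∘ f) ⟩
  toℕ𝔹 (f a) + ℕSum.sum (zeroAt a (toℕ𝔹 ∘ f))   ≡⟨ cong₂ _+_ (cong toℕ𝔹 fa) (ℕSum.sum-cong-≗ removed) ⟩
  suc (count (λ i → f i xor ⌊ a ≟ i ⌋))         ∎
  where
  removed : ∀ i → zeroAt a (toℕ𝔹 ∘ f) i ≡ toℕ𝔹 (f i xor ⌊ a ≟ i ⌋)
  removed i with a ≟ i
  ... | yes refl = cong (λ b → toℕ𝔹 (b xor true)) (sym fa)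
  ... | no _     = cong toℕ𝔹 (sym (xor-identityʳ (f i)))

foldr-tabulate : ∀ {A B : Set} (_∙_ : A → A → A) ε {n} (f : B → A) (g : Fin n → B) →
                 List.foldr _∙_ ε (List.map f (tabulate g)) ≡ Vector.foldr _∙_ ε (f ∘ g)
foldr-tabulate _∙_ ε {zero}  f g = refl
foldr-tabulate _∙_ ε {suc n} f g = cong (f (g zero) ∙_) (foldr-tabulate _∙_ ε f (g ∘ suc))

-- The Kempe game on boundary words

Word : Set
Word = Fin 6 → Colour

switch : Colour → Fin 6 → Fin 6 → Word → Word
switch z i k s j = if ⌊ i ≟ j ⌋ xor ⌊ k ≟ j ⌋ then third z (s j) else s j

Balanced : Word → Set
Balanced s = ∀ z → parity (λ j → π z (col (s j))) ≡ false

-- In a switch we choose z and i, but the partner k is imposed by the graph.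
data Solvable : ℕ → Word → Set where
  good  : ∀ {d s} → GoodString (col ∘ s) → Solvable d s
  kempe : ∀ {d s} z i → s i ≢ z →
          (∀ k → k ≢ i → s k ≢ z → Solvable d (switch z i k s)) → Solvable (suc d) s

GoodString-resp : ∀ {a b : Fin 6 → Z2²} → (∀ i → a i ≡ b i) → GoodString a → GoodString b
GoodString-resp {a} {b} a≗b =
  Sum.map triple (Sum.map triple (Sum.map triple (Sum.map triple (Sum.map triple triple))))
  where
  pair : ∀ {i j} → a i ≡ a j → b i ≡ b j
  pair {i} {j} p = trans (sym (a≗b i)) (trans p (a≗b j))
  triple : ∀ {i j k l p q} → a i ≡ a j × a k ≡ a l × a p ≡ a q → b i ≡ b j × b k ≡ b l × b p ≡ b q
  triple (x , y , z) = pair x , pair y , pair z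

good? : ∀ a → Dec (GoodString a)
good? a = a f0 ≟² a f1 ×-dec a f2 ≟² a f3 ×-dec a f4 ≟² a f5
   ⊎-dec a f0 ≟² a f5 ×-dec a f1 ≟² a f2 ×-dec a f3 ≟² a f4
   ⊎-dec a f0 ≟² a f3 ×-dec a f1 ≟² a f2 ×-dec a f4 ≟² a f5
   ⊎-dec a f0 ≟² a f5 ×-dec a f1 ≟² a f4 ×-dec a f2 ≟² a f3
   ⊎-dec a f0 ≟² a f1 ×-dec a f2 ≟² a f5 ×-dec a f3 ≟² a f4
   ⊎-dec a f0 ≟² a f3 ×-dec a f1 ≟² a f4 ×-dec a f2 ≟² a f5
  where
  _≟²_ : DecidableEquality Z2²
  _≟²_ = ≡-dec _≟ᵇ_ _≟ᵇ_

all-colours? : {P : Colour → Set} → (∀ c → Dec (P c)) → Dec (∀ c → P c)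
all-colours? P? = map′ (λ { (r , g , b) red → r ; (r , g , b) green → g ; (r , g , b) blue → b })
                       (λ f → f red , f green , f blue)
                       (P? red ×-dec P? green ×-dec P? blue)

any-colour? : {P : Colour → Set} → (∀ c → Dec (P c)) → Dec (∃ P)
any-colour? P? = map′ (λ { (inj₁ r) → red , r ; (inj₂ (inj₁ g)) → green , g ; (inj₂ (inj₂ b)) → blue , b })
                      (λ { (red , r) → inj₁ r ; (green , g) → inj₂ (inj₁ g) ; (blue , b) → inj₂ (inj₂ b) })
                      (P? red ⊎-dec P? green ⊎-dec P? blue)

all-words? : ∀ {n} {P : Vec Colour n → Set} → (∀ v → Dec (P v)) → Dec (∀ v → P v)
all-words? {zero}  P? = map′ (λ { p [] → p }) (λ f → f []) (P? [])
all-words? {suc n} P? = map′ (λ { f (c ∷ v) → f c v }) (λ f c v → f (c ∷ v))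
                             (all-colours? λ c → all-words? λ v → P? (c ∷ v))

solvable? : ∀ d s → Dec (Solvable d s)
solvable? zero    s = map′ good (λ { (good g) → g }) (good? (col ∘ s))
solvable? (suc d) s =
  map′ (λ { (inj₁ g) → good g ; (inj₂ (z , i , si≢z , next)) → kempe z i si≢z next })
       (λ { (good g) → inj₁ g ; (kempe z i si≢z next) → inj₂ (z , i , si≢z , next) })
       (good? (col ∘ s) ⊎-dec any-colour? λ z → any? λ i → ¬? (s i ≟ᶜ z) ×-dec
          all? λ k → ¬? (k ≟ i) →-dec ¬? (s k ≟ᶜ z) →-dec solvable? d (switch z i k s))

balanced? : ∀ s → Dec (Balanced s)
balanced? s = all-colours? λ z → parity (λ j → π z (col (s j))) ≟ᵇ false

balanced⇒solvable : ∀ w → Balanced (lookup w) → Solvable 2 (lookup w)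
balanced⇒solvable =
  toWitness {a? = all-words? λ w → balanced? (lookup w) →-dec solvable? 2 (lookup w)} _

-- Boundaries of edge sets

xor-telescope : ∀ a b c → (a xor b) xor (b xor c) ≡ a xor c
xor-telescope a b c = begin
  (a xor b) xor (b xor c) ≡⟨ xor-assoc a b (b xor c) ⟩
  a xor (b xor (b xor c)) ≡⟨ cong (a xor_) (xor-assoc b b c) ⟨
  a xor ((b xor b) xor c) ≡⟨ cong (λ x → a xor (x xor c)) (xor-same b) ⟩
  a xor c                 ∎

xor-true-⊆ : ∀ a b → (b ≡ true → a ≡ true) → a xor b ≡ true → a ≡ true
xor-true-⊆ true  _ _   _ = refl
xor-true-⊆ false _ b⇒a b = b⇒a b

∧-true : ∀ a b → a ∧ b ≡ true → a ≡ true × b ≡ true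
∧-true true true _ = refl , refl

module Boundary (G : Graph) where

  ∂ : (Edge G → Bool) → Vertex G → Bool
  ∂ t u = parity (λ e → inBoundary G e u ∧ t e)

  ∂-xor : ∀ t t′ u → ∂ (λ e → t e xor t′ e) u ≡ ∂ t u xor ∂ t′ u
  ∂-xor t t′ u =
    trans (parity-cong (λ e → ∧-distribˡ-xor (inBoundary G e u) (t e) (t′ e)))
          (Parity.∑-distrib-+ (λ e → inBoundary G e u ∧ t e) (λ e → inBoundary G e u ∧ t′ e))

  ∂-∧ : ∀ t b u → ∂ (λ e → t e ∧ b) u ≡ ∂ t u ∧ b
  ∂-∧ t b u = trans (parity-cong (λ e → sym (∧-assoc (inBoundary G e u) (t e) b)))
                    (parity-∧ʳ (λ e → inBoundary G e u ∧ t e) b)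

  ∂-∅ : ∀ u → ∂ (λ _ → false) u ≡ false
  ∂-∅ u = trans (parity-cong (λ e → ∧-zeroʳ (inBoundary G e u))) (parity-false (m G))

  ∂-edge : ∀ e u → ∂ (λ e′ → ⌊ e ≟ e′ ⌋) u ≡ inBoundary G e u
  ∂-edge e u = trans (parity-cong (λ e′ → ∧-comm (inBoundary G e′ u) _))
                     (parity-select e (λ e′ → inBoundary G e′ u))

  edge-boundary-even : ∀ e → parity (inBoundary G e) ≡ false
  edge-boundary-even e =
    trans (Parity.∑-distrib-+ (λ u → ⌊ proj₁ (ends G e) ≟ u ⌋) (λ u → ⌊ proj₂ (ends G e) ≟ u ⌋))
          (cong₂ _xor_ (parity-single (proj₁ (ends G e))) (parity-single (proj₂ (ends G e))))

  handshake : ∀ t → parity (∂ t) ≡ false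
  handshake t = begin
    parity (λ u → parity (λ e → inBoundary G e u ∧ t e)) ≡⟨ Parity.∑-comm (λ u e → inBoundary G e u ∧ t e) ⟩
    parity (λ e → parity (λ u → inBoundary G e u ∧ t e)) ≡⟨ parity-cong (λ e → parity-∧ʳ (inBoundary G e) (t e)) ⟩
    parity (λ e → parity (inBoundary G e) ∧ t e)         ≡⟨ parity-cong (λ e → cong (_∧ t e) (edge-boundary-even e)) ⟩
    parity {m G} (λ _ → false)                           ≡⟨ parity-false (m G) ⟩
    false                                                ∎

  inBoundary-other : ∀ e w → inBoundary G e w ≡ true →
                     Σ (Vertex G) λ w′ → ∀ u → inBoundary G e u ≡ ⌊ w ≟ u ⌋ xor ⌊ w′ ≟ u ⌋
  inBoundary-other e w leaves with proj₁ (ends G e) ≟ w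
  ... | yes p≡w = proj₂ (ends G e) , λ u → cong (λ x → ⌊ x ≟ u ⌋ xor _) p≡w
  ... | no _    = proj₁ (ends G e) , λ u →
    trans (xor-comm ⌊ proj₁ (ends G e) ≟ u ⌋ ⌊ proj₂ (ends G e) ≟ u ⌋)
          (cong (λ x → ⌊ x ≟ u ⌋ xor _) (⌊⌋-sound (proj₂ (ends G e) ≟ w) leaves))

  π-foldr : ∀ z {k} (f : Fin k → Z2²) → π z (Vector.foldr _⊕_ 0ᶻ f) ≡ parity (π z ∘ f)
  π-foldr z {zero}  f = π-0 z
  π-foldr z {suc k} f = trans (π-⊕ z (f zero) _) (cong (π z (f zero) xor_) (π-foldr z (f ∘ suc)))

  π-boundarySum : ∀ z φ u → π z (boundarySum G φ u) ≡ ∂ (π z ∘ φ) u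
  π-boundarySum z φ u = begin
    π z (boundarySum G φ u)
      ≡⟨ cong (π z) (foldr-tabulate _⊕_ 0ᶻ summand (λ e → e)) ⟩
    π z (Vector.foldr _⊕_ 0ᶻ summand)
      ≡⟨ π-foldr z summand ⟩
    parity (π z ∘ summand)
      ≡⟨ parity-cong (λ e → π-if (inBoundary G e u)) ⟩
    ∂ (π z ∘ φ) u
      ∎
    where
    summand : Edge G → Z2²
    summand e = if inBoundary G e u then φ e else 0ᶻ
    π-if : ∀ {x} b → π z (if b then x else 0ᶻ) ≡ b ∧ π z x
    π-if true  = refl
    π-if false = π-0 z

  zeroSum⇒∂ : ∀ φ u → ZeroSum G φ u → ∀ z → ∂ (π z ∘ φ) u ≡ false
  zeroSum⇒∂ φ u zero-sum z = trans (sym (π-boundarySum z φ u)) (trans (cong (π z) zero-sum) (π-0 z))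

  ∂⇒zeroSum : ∀ φ u → (∀ z → ∂ (π z ∘ φ) u ≡ false) → ZeroSum G φ u
  ∂⇒zeroSum φ u even = ≡0-by-π _ (trans (π-boundarySum red φ u) (even red))
                                 (trans (π-boundarySum green φ u) (even green))

  recolour : (Edge G → Bool) → Colour → Chain G → Chain G
  recolour t z φ e = if t e then φ e ⊕ col z else φ e

  ∂-recolour : ∀ t z φ w u → ∂ (π w ∘ recolour t z φ) u ≡ ∂ (π w ∘ φ) u xor (∂ t u ∧ π w (col z))
  ∂-recolour t z φ w u = begin
    ∂ (π w ∘ recolour t z φ) u                       ≡⟨ parity-cong (λ e → cong (inBoundary G e u ∧_) (shift e)) ⟩
    ∂ (λ e → π w (φ e) xor (t e ∧ π w (col z))) u    ≡⟨ ∂-xor (π w ∘ φ) _ u ⟩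
    ∂ (π w ∘ φ) u xor ∂ (λ e → t e ∧ π w (col z)) u  ≡⟨ cong (∂ (π w ∘ φ) u xor_) (∂-∧ t _ u) ⟩
    ∂ (π w ∘ φ) u xor (∂ t u ∧ π w (col z))          ∎
    where
    shift : ∀ e → π w (recolour t z φ e) ≡ π w (φ e) xor (t e ∧ π w (col z))
    shift e with t e
    ... | true  = π-⊕ w (φ e) (col z)
    ... | false = sym (xor-identityʳ _)

  recolour-zeroSum : ∀ t z φ u → ZeroSum G φ u → ∂ t u ≡ false → ZeroSum G (recolour t z φ) u
  recolour-zeroSum t z φ u zero-sum even = ∂⇒zeroSum _ u λ w →
    trans (∂-recolour t z φ w u) (cong₂ (λ x y → x xor (y ∧ π w (col z))) (zeroSum⇒∂ φ u zero-sum w) even)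

  recolour-zeros : ∀ t z φ → (∀ e → t e ≡ true → π z (φ e) ≡ true) →
                   ∀ e → (φ e ≡ 0ᶻ → recolour t z φ e ≡ 0ᶻ) × (recolour t z φ e ≡ 0ᶻ → φ e ≡ 0ᶻ)
  recolour-zeros t z φ t⊆ e with t e in te
  ... | false = (λ φe≡0 → φe≡0) , (λ φe≡0 → φe≡0)
  ... | true  = (λ φe≡0 → ⊥-elim (π-true⇒≢0 z _ (t⊆ e te) φe≡0)) ,
                (λ φ′e≡0 → ⊥-elim (π-true⇒≢0 z _ still-odd φ′e≡0))
    where
    still-odd : π z (φ e ⊕ col z) ≡ true
    still-odd = begin
      π z (φ e ⊕ col z)         ≡⟨ π-⊕ z (φ e) (col z) ⟩
      π z (φ e) xor π z (col z) ≡⟨ cong₂ _xor_ (t⊆ e te) (π-col-self z) ⟩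
      true                      ∎

  recolour-colour : ∀ t z φ → (∀ e → t e ≡ true → π z (φ e) ≡ true) →
                    ∀ e c → φ e ≡ col c → recolour t z φ e ≡ col (if t e then third z c else c)
  recolour-colour t z φ t⊆ e c φe≡c with t e in te
  ... | false = φe≡c
  ... | true  = trans (cong (_⊕ col z) φe≡c)
                      (sym (col-third z c (π-col⇒≢ z c (subst (λ x → π z x ≡ true) φe≡c (t⊆ e te)))))

  record Join (H : Edge G → Bool) (s w : Vertex G) : Set where
    field
      edges   : Edge G → Bool
      edges⊆H : ∀ e → edges e ≡ true → H e ≡ true
      ∂-edges : ∀ u → ∂ edges u ≡ ⌊ s ≟ u ⌋ xor ⌊ w ≟ u ⌋

  open Join

  module _ (H : Edge G → Bool) (s : Vertex G) (s-odd : ∂ H s ≡ true) where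

    OddPartner : Set
    OddPartner = Σ (Vertex G) λ w → w ≢ s × ∂ H w ≡ true × Join H s w

    unused : ∀ {w} → Join H s w → Edge G → Bool
    unused J e = H e xor edges J e

    empty : Join H s s
    empty = record
      { edges   = λ _ → false
      ; edges⊆H = λ _ ()
      ; ∂-edges = λ u → trans (∂-∅ u) (sym (xor-same ⌊ s ≟ u ⌋))
      }

    extend : ∀ {w} (J : Join H s w) e → inBoundary G e w ≡ true → unused J e ≡ true →
             Σ (Vertex G) λ w′ → Σ (Join H s w′) λ J′ → count (unused J) ≡ suc (count (unused J′))
    extend {w} J e leaves fresh =
      w′ , J′ , trans (count-remove (unused J) e fresh) (cong suc (ℕSum.sum-cong-≗ reassociate))
      where
      w′ = proj₁ (inBoundary-other e w leaves)
      J′ : Join H s w′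
      edges J′ e′ = edges J e′ xor ⌊ e ≟ e′ ⌋
      edges⊆H J′ e′ added with e ≟ e′
      ... | yes refl = xor-true-⊆ (H e) (edges J e) (edges⊆H J e) fresh
      ... | no _     = edges⊆H J e′ (trans (sym (xor-identityʳ _)) added)
      ∂-edges J′ u = begin
        ∂ (edges J′) u
          ≡⟨ ∂-xor (edges J) _ u ⟩
        ∂ (edges J) u xor ∂ (λ e′ → ⌊ e ≟ e′ ⌋) u
          ≡⟨ cong₂ _xor_ (∂-edges J u) (∂-edge e u) ⟩
        (⌊ s ≟ u ⌋ xor ⌊ w ≟ u ⌋) xor inBoundary G e u
          ≡⟨ cong ((⌊ s ≟ u ⌋ xor ⌊ w ≟ u ⌋) xor_) (proj₂ (inBoundary-other e w leaves) u) ⟩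
        (⌊ s ≟ u ⌋ xor ⌊ w ≟ u ⌋) xor (⌊ w ≟ u ⌋ xor ⌊ w′ ≟ u ⌋)
          ≡⟨ xor-telescope ⌊ s ≟ u ⌋ ⌊ w ≟ u ⌋ ⌊ w′ ≟ u ⌋ ⟩
        ⌊ s ≟ u ⌋ xor ⌊ w′ ≟ u ⌋
          ∎
      reassociate : ∀ e′ → toℕ𝔹 (unused J e′ xor ⌊ e ≟ e′ ⌋) ≡ toℕ𝔹 (unused J′ e′)
      reassociate e′ = cong toℕ𝔹 (xor-assoc (H e′) (edges J e′) _)

    advance : ∀ {w} (J : Join H s w) → ∂ (unused J) w ≡ true →
              Σ (Vertex G) λ w′ → Σ (Join H s w′) λ J′ → count (unused J) ≡ suc (count (unused J′))
    advance {w} J odd with parity-true⇒∃ _ odd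
    ... | e , at-w = extend J e (proj₁ (∧-true _ _ at-w)) (proj₂ (∧-true _ _ at-w))

    -- the walk can go on from s, and from every other vertex that is even in H
    unused-odd : ∀ {w} (J : Join H s w) → w ≡ s ⊎ (w ≢ s × ∂ H w ≡ false) → ∂ (unused J) w ≡ true
    unused-odd {w} J stuck = begin
      ∂ (unused J) w                      ≡⟨ ∂-xor H (edges J) w ⟩
      ∂ H w xor ∂ (edges J) w             ≡⟨ cong (∂ H w xor_) (∂-edges J w) ⟩
      ∂ H w xor (⌊ s ≟ w ⌋ xor ⌊ w ≟ w ⌋)  ≡⟨ cong (λ x → ∂ H w xor (⌊ s ≟ w ⌋ xor x)) (⌊⌋-yes (w ≟ w) refl) ⟩
      ∂ H w xor (⌊ s ≟ w ⌋ xor true)       ≡⟨ odd-total stuck ⟩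
      true                                ∎
      where
      odd-total : w ≡ s ⊎ (w ≢ s × ∂ H w ≡ false) → ∂ H w xor (⌊ s ≟ w ⌋ xor true) ≡ true
      odd-total (inj₁ refl) = cong₂ (λ x y → x xor (y xor true)) s-odd (⌊⌋-yes (s ≟ s) refl)
      odd-total (inj₂ (w≢s , even)) =
        cong₂ (λ x y → x xor (y xor true)) even (⌊⌋-no (s ≟ w) (λ s≡w → w≢s (sym s≡w)))

    walk    : ∀ n {w} (J : Join H s w) → count (unused J) ≡ n → OddPartner
    walk-on : ∀ n {w} (J : Join H s w) → count (unused J) ≡ n → ∂ (unused J) w ≡ true → OddPartner

    walk n {w} J counted with w ≟ s | ∂ H w in w-parity
    ... | yes w≡s | _     = walk-on n J counted (unused-odd J (inj₁ w≡s))
    ... | no w≢s  | true  = w , w≢s , w-parity , J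
    ... | no w≢s  | false = walk-on n J counted (unused-odd J (inj₂ (w≢s , w-parity)))

    walk-on n J counted odd with advance J odd
    walk-on zero    J counted odd | _ , _  , shrinks with () ← trans (sym counted) shrinks
    walk-on (suc n) J counted odd | _ , J′ , shrinks = walk n J′ (suc-injective (trans (sym shrinks) counted))

    odd-partner : OddPartner
    odd-partner = walk _ empty refl

-- Around a circuit of cubic vertices

drop-positive : ∀ {a x n} → 1 ≤ a → a + x ≤ suc n → x ≤ n
drop-positive {x = x} 1≤a a+x≤ = ≤-pred (≤-trans (+-monoˡ-≤ x 1≤a) a+x≤)

xor-of-one : ∀ x y → 1 ≤ toℕ𝔹 x + toℕ𝔹 y → toℕ𝔹 x + toℕ𝔹 y ≤ 1 → x xor y ≡ true
xor-of-one true  true  _  (s≤s ())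
xor-of-one true  false _  _ = refl
xor-of-one false true  _  _ = refl
xor-of-one false false () _

xor-of-none : ∀ x y → toℕ𝔹 x + toℕ𝔹 y ≤ 0 → x xor y ≡ false
xor-of-none false false _ = refl

prev6 : Fin 6 → Fin 6
prev6 zero                               = suc (suc (suc (suc (suc zero))))
prev6 (suc zero)                         = zero
prev6 (suc (suc zero))                   = suc zero
prev6 (suc (suc (suc zero)))             = suc (suc zero)
prev6 (suc (suc (suc (suc zero))))       = suc (suc (suc zero))
prev6 (suc (suc (suc (suc (suc zero))))) = suc (suc (suc (suc zero)))

next6-prev6 : ∀ k → next6 (prev6 k) ≡ k
next6-prev6 zero                               = refl
next6-prev6 (suc zero)                         = refl
next6-prev6 (suc (suc zero))                   = refl
next6-prev6 (suc (suc (suc zero)))             = refl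
next6-prev6 (suc (suc (suc (suc zero))))       = refl
next6-prev6 (suc (suc (suc (suc (suc zero))))) = refl

prev6≢ : ∀ k → k ≢ prev6 k
prev6≢ zero                               ()
prev6≢ (suc zero)                         ()
prev6≢ (suc (suc zero))                   ()
prev6≢ (suc (suc (suc zero)))             ()
prev6≢ (suc (suc (suc (suc zero))))       ()
prev6≢ (suc (suc (suc (suc (suc zero))))) ()

modification-refl : ∀ {G C φ} → Extensible G C φ → Modification G C φ φ
modification-refl ext = ext , λ _ _ → (λ z → z) , (λ z → z)

modification-trans : ∀ {G C φ φ′ φ″} →
                     Modification G C φ φ′ → Modification G C φ′ φ″ → Modification G C φ φ″
modification-trans (_ , same) (ext″ , same′) = ext″ , λ d d∉C →
  (λ z → proj₁ (same′ d d∉C) (proj₁ (same d d∉C) z)) , (λ z → proj₂ (same d d∉C) (proj₂ (same′ d d∉C) z))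

module Circuit (G : Graph) (C : SixCircuit G) (cubic : ∀ i → degree G (vtx C i) ≡ 3)
               (o : Fin 6 → Edge G) (natural : NaturalOrdering G C o) where

  open Boundary G

  incident⇒endsAt : ∀ e v → Incident G e v → 1 ≤ endsAt G e v
  incident⇒endsAt e v (inj₁ p≡v) rewrite ⌊⌋-yes (proj₁ (ends G e) ≟ v) p≡v = s≤s z≤n
  incident⇒endsAt e v (inj₂ q≡v) rewrite ⌊⌋-yes (proj₂ (ends G e) ≟ v) q≡v =
    ≤-trans (s≤s z≤n) (≤-reflexive (+-comm 1 (toℕ𝔹 ⌊ proj₁ (ends G e) ≟ v ⌋)))

  simple-edge : ∀ e v → 1 ≤ endsAt G e v → endsAt G e v ≤ 1 → inBoundary G e v ≡ true
  simple-edge e v = xor-of-one ⌊ proj₁ (ends G e) ≟ v ⌋ ⌊ proj₂ (ends G e) ≟ v ⌋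

  absent-edge : ∀ e v → endsAt G e v ≤ 0 → inBoundary G e v ≡ false
  absent-edge e v = xor-of-none ⌊ proj₁ (ends G e) ≟ v ⌋ ⌊ proj₂ (ends G e) ≟ v ⌋

  joins⇒incident : ∀ e x y → Joins G e x y → Incident G e x × Incident G e y
  joins⇒incident e x y (inj₁ e≡xy) = inj₁ (cong proj₁ e≡xy) , inj₂ (cong proj₂ e≡xy)
  joins⇒incident e x y (inj₂ e≡yx) = inj₂ (cong proj₂ e≡yx) , inj₁ (cong proj₁ e≡yx)

  o∉C : ∀ k j → edg C j ≢ o k
  o∉C k j edg≡o = proj₁ (natural k) (j , edg≡o)

  ends-at-vertex-≤3 : ∀ k {es} → Unique es → sum (List.map (λ e → endsAt G e (vtx C k)) es) ≤ 3
  ends-at-vertex-≤3 k unique =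
    ≤-trans (sum-unique-≤ _ unique)
            (≤-reflexive (trans (sym (foldr-tabulate _+_ 0 (λ e → endsAt G e (vtx C k)) (λ e → e))) (cubic k)))

  circuit-ends : ∀ k → 1 ≤ endsAt G (edg C k) (vtx C k) × 1 ≤ endsAt G (edg C (prev6 k)) (vtx C k)
  circuit-ends k =
    incident⇒endsAt _ _ (proj₁ (joins⇒incident _ _ _ (edg-join C k))) ,
    incident⇒endsAt _ _ (subst (Incident G (edg C (prev6 k))) (cong (vtx C) (next6-prev6 k))
                                (proj₂ (joins⇒incident _ _ _ (edg-join C (prev6 k)))))

  edg≢edg-prev : ∀ k → edg C k ≢ edg C (prev6 k)
  edg≢edg-prev k e = prev6≢ k (edg-inj C _ _ e)

  remaining-ends-≤1 : ∀ k {es} → Unique (edg C k ∷ edg C (prev6 k) ∷ es) →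
                      sum (List.map (λ e → endsAt G e (vtx C k)) es) ≤ 1
  remaining-ends-≤1 k unique =
    drop-positive (proj₂ (circuit-ends k)) (drop-positive (proj₁ (circuit-ends k)) (ends-at-vertex-≤3 k unique))

  inBoundary-o : ∀ k → inBoundary G (o k) (vtx C k) ≡ true
  inBoundary-o k = simple-edge (o k) (vtx C k) (incident⇒endsAt _ _ (proj₂ (natural k)))
    (subst (_≤ 1) (+-identityʳ _) (remaining-ends-≤1 k {o k ∷ []}
      ((edg≢edg-prev k ∷ o∉C k k ∷ []) ∷ (o∉C k (prev6 k) ∷ []) ∷ [] ∷ [])))

  inBoundary-elsewhere : ∀ k e → ¬ InE C e → e ≢ o k → inBoundary G e (vtx C k) ≡ false
  inBoundary-elsewhere k e e∉C e≢o = absent-edge e (vtx C k)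
    (subst (_≤ 0) (+-identityʳ _) (drop-positive (incident⇒endsAt _ _ (proj₂ (natural k)))
      (remaining-ends-≤1 k {o k ∷ e ∷ []}
        ((edg≢edg-prev k ∷ o∉C k k ∷ (λ edg≡e → e∉C (k , edg≡e)) ∷ [])
         ∷ (o∉C k (prev6 k) ∷ (λ edg≡e → e∉C (prev6 k , edg≡e)) ∷ [])
         ∷ ((λ o≡e → e≢o (sym o≡e)) ∷ []) ∷ [] ∷ []))))

  ∂-at-circuit : ∀ t → (∀ j → t (edg C j) ≡ false) → ∀ k → ∂ t (vtx C k) ≡ t (o k)
  ∂-at-circuit t t-off-C k = trans (parity-cong only-o) (parity-select (o k) t)
    where
    only-o : ∀ e → inBoundary G e (vtx C k) ∧ t e ≡ ⌊ o k ≟ e ⌋ ∧ t e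
    only-o e with o k ≟ e
    ... | yes refl = cong (_∧ t (o k)) (inBoundary-o k)
    ... | no o≢e with t e in te
    ...   | false = ∧-zeroʳ _
    ...   | true  = cong (_∧ true) (inBoundary-elsewhere k e
                      (λ { (j , refl) → not-¬ (t-off-C j) te }) (λ e≡o → o≢e (sym e≡o)))

  inBoundary⇒incident : ∀ e u → inBoundary G e u ≡ true → Incident G e u
  inBoundary⇒incident e u leaves with proj₁ (ends G e) ≟ u
  ... | yes p≡u = inj₁ p≡u
  ... | no _    = inj₂ (⌊⌋-sound (proj₂ (ends G e) ≟ u) leaves)

  incident-on-circuit : ∀ j u → Incident G (edg C j) u → InV C u
  incident-on-circuit j u at-u with edg-join C j | at-u
  ... | inj₁ e≡xy | inj₁ p≡u = j , trans (sym (cong proj₁ e≡xy)) p≡u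
  ... | inj₁ e≡xy | inj₂ q≡u = next6 j , trans (sym (cong proj₂ e≡xy)) q≡u
  ... | inj₂ e≡yx | inj₁ p≡u = next6 j , trans (sym (cong proj₁ e≡yx)) p≡u
  ... | inj₂ e≡yx | inj₂ q≡u = j , trans (sym (cong proj₂ e≡yx)) q≡u

  off-circuit-edges : ∀ {u} → ¬ InV C u → ∀ e → inBoundary G e u ≡ true → ¬ InE C e
  off-circuit-edges {u} u∉C e leaves (j , refl) =
    u∉C (incident-on-circuit j u (inBoundary⇒incident e u leaves))

  parity-on-circuit : ∀ (f : Vertex G → Bool) → (∀ u → ¬ InV C u → f u ≡ false) →
                      parity f ≡ parity (f ∘ vtx C)
  parity-on-circuit f off = parity-image (vtx C) (λ {i} {j} → vtx-inj C i j) f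
                                         (λ u ∉image → off u (λ { (k , vk≡u) → ∉image k vk≡u }))

  boundary-parity : ∀ t → (∀ j → t (edg C j) ≡ false) → (∀ u → ¬ InV C u → ∂ t u ≡ false) →
                    parity (t ∘ o) ≡ false
  boundary-parity t t-off-C even = begin
    parity (t ∘ o)                ≡⟨ parity-cong (λ k → ∂-at-circuit t t-off-C k) ⟨
    parity (λ k → ∂ t (vtx C k))  ≡⟨ parity-on-circuit (∂ t) even ⟨
    parity (∂ t)                  ≡⟨ handshake t ⟩
    false                         ∎

  inCircuit : Edge G → Bool
  inCircuit e = ⌊ any? (λ j → edg C j ≟ e) ⌋

  module _ (φ : Chain G) (ext : Extensible G C φ) where

    kempeEdges : Colour → Edge G → Bool
    kempeEdges z e = π z (φ e) ∧ not (inCircuit e)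

    kempeEdges-off-C : ∀ z j → kempeEdges z (edg C j) ≡ false
    kempeEdges-off-C z j =
      trans (cong (λ b → π z (φ (edg C j)) ∧ not b) (⌊⌋-yes (any? (λ i → edg C i ≟ edg C j)) (j , refl)))
            (∧-zeroʳ _)

    kempeEdges-off : ∀ z e → ¬ InE C e → kempeEdges z e ≡ π z (φ e)
    kempeEdges-off z e e∉C =
      trans (cong (λ b → π z (φ e) ∧ not b) (⌊⌋-no (any? (λ i → edg C i ≟ e)) e∉C)) (∧-identityʳ _)

    ∂-kempeEdges-outside : ∀ z u → ¬ InV C u → ∂ (kempeEdges z) u ≡ false
    ∂-kempeEdges-outside z u u∉C = trans (parity-cong outside) (zeroSum⇒∂ φ u (ext u u∉C) z)
      where
      outside : ∀ e → inBoundary G e u ∧ kempeEdges z e ≡ inBoundary G e u ∧ π z (φ e)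
      outside e with inBoundary G e u in leaves
      ... | false = refl
      ... | true  = kempeEdges-off z e (off-circuit-edges u∉C e leaves)

    ∂-kempeEdges-circuit : ∀ z k → ∂ (kempeEdges z) (vtx C k) ≡ π z (φ (o k))
    ∂-kempeEdges-circuit z k = trans (∂-at-circuit (kempeEdges z) (kempeEdges-off-C z) k)
                                     (kempeEdges-off z (o k) (proj₁ (natural k)))

    boundary-balanced : ∀ z → parity (λ k → π z (φ (o k))) ≡ false
    boundary-balanced z =
      trans (parity-cong (λ k → sym (kempeEdges-off z (o k) (proj₁ (natural k)))))
            (boundary-parity (kempeEdges z) (kempeEdges-off-C z) (∂-kempeEdges-outside z))

    record KempeChain (z : Colour) (i : Fin 6) : Set where
      field
        partner      : Fin 6
        partner≢i    : partner ≢ i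
        edges        : Edge G → Bool
        edges⊆       : ∀ e → edges e ≡ true → π z (φ e) ≡ true
        even-outside : ∀ u → ¬ InV C u → ∂ edges u ≡ false
        at-boundary  : ∀ j → edges (o j) ≡ ⌊ i ≟ j ⌋ xor ⌊ partner ≟ j ⌋

      partner-odd : π z (φ (o partner)) ≡ true
      partner-odd = edges⊆ (o partner) (trans (at-boundary partner)
        (cong₂ _xor_ (⌊⌋-no (i ≟ partner) (λ i≡k → partner≢i (sym i≡k))) (⌊⌋-yes (partner ≟ partner) refl)))

      modification : Modification G C φ (recolour edges z φ)
      modification = (λ u u∉C → recolour-zeroSum edges z φ u (ext u u∉C) (even-outside u u∉C)) ,
                     (λ d _ → recolour-zeros edges z φ edges⊆ d)

    kempe-chain : ∀ z i → π z (φ (o i)) ≡ true → KempeChain z i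
    kempe-chain z i i-odd with odd-partner (kempeEdges z) (vtx C i) (trans (∂-kempeEdges-circuit z i) i-odd)
    ... | w , w≢vi , w-odd , J with any? (λ k → vtx C k ≟ w)
    ...   | no w∉C with () ← trans (sym w-odd) (∂-kempeEdges-outside z w w∉C)
    ...   | yes (k , refl) = record
      { partner      = k
      ; partner≢i    = λ k≡i → w≢vi (cong (vtx C) k≡i)
      ; edges        = Join.edges J
      ; edges⊆       = λ e e∈J → proj₁ (∧-true _ _ (Join.edges⊆H J e e∈J))
      ; even-outside = λ u u∉C → trans (Join.∂-edges J u)
          (cong₂ _xor_ (⌊⌋-no (vtx C i ≟ u) (λ vi≡u → u∉C (i , vi≡u)))
                       (⌊⌋-no (vtx C k ≟ u) (λ vk≡u → u∉C (k , vk≡u))))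
      ; at-boundary  = λ j → begin
          Join.edges J (o j)                              ≡⟨ ∂-at-circuit (Join.edges J) J-off-C j ⟨
          ∂ (Join.edges J) (vtx C j)                      ≡⟨ Join.∂-edges J (vtx C j) ⟩
          ⌊ vtx C i ≟ vtx C j ⌋ xor ⌊ vtx C k ≟ vtx C j ⌋  ≡⟨ cong₂ _xor_ (vtx-≟ i j) (vtx-≟ k j) ⟩
          ⌊ i ≟ j ⌋ xor ⌊ k ≟ j ⌋                          ∎
      }
      where
      vtx-≟ : ∀ a b → ⌊ vtx C a ≟ vtx C b ⌋ ≡ ⌊ a ≟ b ⌋
      vtx-≟ = ⌊≟⌋-injective (vtx C) (λ {a} {b} → vtx-inj C a b)
      J-off-C : ∀ j → Join.edges J (edg C j) ≡ false
      J-off-C j with Join.edges J (edg C j) in e∈J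
      ... | false = refl
      ... | true  with () ← trans (sym (kempeEdges-off-C z j)) (Join.edges⊆H J (edg C j) e∈J)

  Result : Chain G → Set
  Result φ = Σ (Chain G) λ φ′ → Modification G C φ φ′ × GoodString (λ i → φ′ (o i))

  Result-after : ∀ {φ φ′} → Modification G C φ φ′ → Result φ′ → Result φ
  Result-after {φ} {φ′} φ→φ′ (φ″ , φ′→φ″ , good″) =
    φ″ , modification-trans {G} {C} {φ} {φ′} {φ″} φ→φ′ φ′→φ″ , good″

  solve : ∀ {d s} → Solvable d s → ∀ φ → Extensible G C φ → (∀ j → φ (o j) ≡ col (s j)) → Result φ
  solve (good g) φ ext colours = φ , modification-refl {G} {C} ext , GoodString-resp (λ j → sym (colours j)) g
  solve {s = s} (kempe z i si≢z next) φ ext colours =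
    Result-after modification
      (solve (next partner partner≢i partner-colour) (recolour edges z φ) (proj₁ modification) recoloured)
    where
    open KempeChain (kempe-chain φ ext z i (subst (λ x → π z x ≡ true) (sym (colours i)) (π-col z (s i) si≢z)))
    partner-colour : s partner ≢ z
    partner-colour = π-col⇒≢ z (s partner) (subst (λ x → π z x ≡ true) (colours partner) partner-odd)
    recoloured : ∀ j → recolour edges z φ (o j) ≡ col (switch z i partner s j)
    recoloured j = trans (recolour-colour edges z φ edges⊆ (o j) (s j) (colours j))
                         (cong (λ b → col (if b then third z (s j) else s j)) (at-boundary j))

lemma7 : (G : Graph) → Bridgeless G →
    (C : SixCircuit G) → (∀ i → degree G (vtx C i) ≡ 3) →
    (φ : Chain G) → Extensible G C φ → NowhereZeroBoundary G C φ →
    (o : Fin 6 → Edge G) → NaturalOrdering G C o →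
    Σ (Chain G) (λ φ' → Modification G C φ φ' × GoodString (λ i → φ' (o i)))
lemma7 G _ C cubic φ ext nowhere-zero o natural = solve (balanced⇒solvable word balanced) φ ext colours
  where
  open Circuit G C cubic o natural
  word : Vec Colour 6
  word = Vec.tabulate (λ k → colour (φ (o k)))
  boundary-nonzero : ∀ k → φ (o k) ≢ 0ᶻ
  boundary-nonzero k = nowhere-zero (o k) (proj₁ (natural k)) (vtx C k) (k , refl) (proj₂ (natural k))
  colours : ∀ k → φ (o k) ≡ col (lookup word k)
  colours k = begin
    φ (o k)                 ≡⟨ col-colour (φ (o k)) (boundary-nonzero k) ⟨
    col (colour (φ (o k)))  ≡⟨ cong col (lookup∘tabulate (λ k → colour (φ (o k))) k) ⟨
    col (lookup word k)     ∎
  balanced : Balanced (lookup word)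
  balanced z = trans (parity-cong (λ k → cong (π z) (sym (colours k)))) (boundary-balanced φ ext z)
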